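{- For any reals $x,t\ge1$ and $0<c\le1$, $$\left|\left\{n\le x:\ \sum_{\substack{p\mid n\\ p\ge t}}\frac1p\ge c\right\}\right|\ll x e^{ -100ct}$$ with an absolute implied constant, where $n$ ranges over positive integers and $p$ over primes.
   Formalization: The parameters x, t and c range over the rationals rather than the reals. -}

module Defs where

open import Data.Nat as ℕ using (ℕ; zero; suc)
open import Data.Nat.Divisibility using (_∣?_)
open import Data.Nat.Primality using (prime?)
open import Data.Integer as ℤ using (+_)
open import Data.Rational as ℚ using (ℚ; 0ℚ; 1ℚ; _/_; floor)
open import Data.Rational.Properties using (_≤?_)
open import Data.List using (List; filter; map; foldr; upTo; length)
open import Relation.Nullary.Decidable using (_×-dec_)

ℕ→ℚ : ℕ → ℚ
ℕ→ℚ n = + n / 1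

-- 1/p for p ≥ 1 (value at 0 is irrelevant; only used for primes)
recip : ℕ → ℚ
recip zero    = 0ℚ
recip (suc k) = + 1 / suc k

sumℚ : List ℚ → ℚ
sumℚ = foldr ℚ._+_ 0ℚ

-- the primes p with p ∣ n and p ≥ t  (all such p lie in 0..n for n ≥ 1)
primeDivisorsFrom : ℚ → ℕ → List ℕ
primeDivisorsFrom t n =
  filter (λ p → prime? p ×-dec (p ∣? n) ×-dec (t ≤? ℕ→ℚ p)) (upTo (suc n))

S : ℚ → ℕ → ℚ
S t n = sumℚ (map recip (primeDivisorsFrom t n))

positivesUpTo : ℚ → List ℕ
positivesUpTo x = map suc (upTo ℤ.∣ floor x ∣)

count : ℚ → ℚ → ℚ → ℕ
count x t c = length (filter (λ n → c ≤? S t n) (positivesUpTo x))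

expTerm : ℚ → ℕ → ℚ
expTerm y zero    = 1ℚ
expTerm y (suc k) = expTerm y k ℚ.* y ℚ.* recip (suc k)

-- Σ_{k < N} y^k / k!   (partial sums of the exponential series; e^y = sup_N of these for y ≥ 0)
expPartial : ℚ → ℕ → ℚ
expPartial y N = sumℚ (map (expTerm y) (upTo N))

-- Rankin's trick.  Write E = Σ_{k<N} y^k/k! for the partial sums of the exponential; all
-- bounds below hold for every N.  From E(x + a) ≤ E(x) + a E(x + a) one gets
-- E(x + a) ≤ (1 + 2a) E(x) for a ≤ 1/2, hence E(x + 100 u) ≤ (1 + u)^200 E(x) ≤ (1 + K u) E(x)
-- for 0 ≤ u ≤ 1 with K = 2^200.  Applied with u = t/p for the primes p ∣ n with p ≥ t this gives,
-- whenever S(n) ≥ c, E(100 c t) ≤ f(n) := ∏_{p ∣ n, p ≥ t} (1 + K t/p).  Summing f over n ≤ Y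
-- prime by prime (the n divisible by p are p j with j ≤ Y/p, and f restricted to primes < p
-- satisfies f(p j) ≤ f(j)) gives Σ_{n ≤ Y} f(n) ≤ Y ∏_{p ≥ t} (1 + K t/p²).  Finally, as
-- 1 + K t/m² ≤ (((m + 1 + t)(m + 2t)) / ((m + t)(m + 1 + 2t)))^J for m ≥ t and J = 9K,
-- the Euler product telescopes to at most 2^J.

module Submission where

open import Defs
open import Data.Nat using (ℕ)
open import Data.Product using (∃-syntax)
open import Data.Rational using (ℚ; _≤_; _<_; _*_; 0ℚ; 1ℚ)

open import Level using (0ℓ)
open import Function using (_∘_)
open import Data.Bool using (true; false; if_then_else_; _∧_)
open import Data.Empty using (⊥-elim)
open import Data.Product using (_×_; _,_; proj₁)
open import Data.Sum using (_⊎_; inj₁; inj₂)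
open import Data.Maybe using (Maybe; just; nothing)
open import Data.Nat as ℕ using (zero; suc; z≤n; s≤s)
import Data.Nat.Properties as ℕₚ
open import Data.Nat.Coprimality as Coprime using (1-coprimeTo)
open import Data.Nat.Divisibility using (_∣_; _∣?_; divides)
open import Data.Nat.Primality using (Prime; prime?; euclidsLemma; prime⇒irreducible; ¬prime[0]; ¬prime[1])
import Data.Integer as ℤ
import Data.Integer.Properties as ℤₚ
import Data.Integer.DivMod as ℤ
import Data.Nat.DivMod as ℕ
open import Data.Rational using (mkℚ; _+_; -_; ½; floor; *≤*; nonNegative; positive)
import Data.Rational.Properties as ℚₚ
open import Data.List using (List; []; _∷_; _++_; [_]; map; foldr; filter; length; upTo)
import Data.List.Properties as List
open import Data.List.Relation.Unary.All as All using (All; []; _∷_)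
import Data.List.Relation.Unary.All.Properties as All
open import Relation.Nullary using (Dec; does; yes; no; ¬_)
open import Relation.Nullary.Decidable using (dec-true; dec-false; _×-dec_)
open import Relation.Unary using (Pred; Decidable)
open import Relation.Binary.PropositionalEquality
  using (_≡_; refl; sym; trans; cong; cong₂; subst; subst₂; module ≡-Reasoning)
open import Tactic.RingSolver using (solve-∀)
open import Tactic.RingSolver.Core.AlmostCommutativeRing using (AlmostCommutativeRing; fromCommutativeRing)
open import Algebra.Bundles using (CommutativeRing)
open import Algebra.Properties.CommutativeSemiring.Exp
  (CommutativeRing.commutativeSemiring ℚₚ.+-*-commutativeRing) using (_^_; ^-distrib-*)

open ℚₚ using (≤-refl; ≤-reflexive; ≤-trans; <⇒≤; +-mono-≤; +-monoˡ-≤; +-monoʳ-≤; module ≤-Reasoning)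

ℚ-ring : AlmostCommutativeRing 0ℓ 0ℓ
ℚ-ring = fromCommutativeRing ℚₚ.+-*-commutativeRing 0≟
  where
  0≟ : ∀ p → Maybe (0ℚ ≡ p)
  0≟ p with 0ℚ ℚₚ.≟ p
  ... | yes 0≡p = just 0≡p
  ... | no  _   = nothing

+-nonNeg : ∀ {p q} → 0ℚ ≤ p → 0ℚ ≤ q → 0ℚ ≤ p + q
+-nonNeg = +-mono-≤

*-nonNeg : ∀ {p q} → 0ℚ ≤ p → 0ℚ ≤ q → 0ℚ ≤ p * q
*-nonNeg {p} {q} 0≤p 0≤q =
  ℚₚ.nonNegative⁻¹ (p * q) {{ℚₚ.nonNeg*nonNeg⇒nonNeg p {{nonNegative 0≤p}} q {{nonNegative 0≤q}}}}

*-monoˡ-≤ : ∀ {p q} r → 0ℚ ≤ r → p ≤ q → r * p ≤ r * q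
*-monoˡ-≤ r 0≤r = ℚₚ.*-monoˡ-≤-nonNeg r {{nonNegative 0≤r}}

*-monoʳ-≤ : ∀ {p q} r → 0ℚ ≤ r → p ≤ q → p * r ≤ q * r
*-monoʳ-≤ r 0≤r = ℚₚ.*-monoʳ-≤-nonNeg r {{nonNegative 0≤r}}

*-mono-≤ : ∀ {p q r s} → 0ℚ ≤ p → 0ℚ ≤ r → p ≤ q → r ≤ s → p * r ≤ q * s
*-mono-≤ {q = q} {r} 0≤p 0≤r p≤q r≤s = ≤-trans (*-monoʳ-≤ r 0≤r p≤q) (*-monoˡ-≤ q (≤-trans 0≤p p≤q) r≤s)

*-cancelʳ-≤ : ∀ {p q} r → 0ℚ < r → p * r ≤ q * r → p ≤ q
*-cancelʳ-≤ r 0<r = ℚₚ.*-cancelʳ-≤-pos r {{positive 0<r}}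

+-cancelʳ-≤ : ∀ {p q} r → p + r ≤ q + r → p ≤ q
+-cancelʳ-≤ {p} {q} r p+r≤q+r = subst₂ _≤_ (+-r-r p r) (+-r-r q r) (+-monoˡ-≤ (- r) p+r≤q+r)
  where
  +-r-r : ∀ p r → p + r + - r ≡ p
  +-r-r = solve-∀ ℚ-ring

p≤p+q : ∀ p {q} → 0ℚ ≤ q → p ≤ p + q
p≤p+q p {q} 0≤q = subst (_≤ p + q) (ℚₚ.+-identityʳ p) (+-monoʳ-≤ p 0≤q)

0≤1 : 0ℚ ≤ 1ℚ
0≤1 = ℚₚ.≤ᵇ⇒≤ _

if-nonNeg : ∀ b {p} → 0ℚ ≤ p → 0ℚ ≤ (if b then p else 0ℚ)
if-nonNeg true  0≤p = 0≤p
if-nonNeg false _   = ≤-refl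

^-nonNeg : ∀ {p} j → 0ℚ ≤ p → 0ℚ ≤ p ^ j
^-nonNeg zero    0≤p = 0≤1
^-nonNeg (suc j) 0≤p = *-nonNeg 0≤p (^-nonNeg j 0≤p)

^-pos : ∀ {p} j → 0ℚ < p → 0ℚ < p ^ j
^-pos {p} zero    0<p = ℚₚ.positive⁻¹ 1ℚ
^-pos {p} (suc j) 0<p = ℚₚ.positive⁻¹ (p * p ^ j)
  {{ℚₚ.pos*pos⇒pos p {{positive 0<p}} (p ^ j) {{positive (^-pos j 0<p)}}}}

^-monoˡ-≤ : ∀ {p q} j → 0ℚ ≤ p → p ≤ q → p ^ j ≤ q ^ j
^-monoˡ-≤ zero    0≤p p≤q = ≤-refl
^-monoˡ-≤ (suc j) 0≤p p≤q = *-mono-≤ 0≤p (^-nonNeg j 0≤p) p≤q (^-monoˡ-≤ j 0≤p p≤q)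

ℕ→ℚ≡mkℚ : ∀ n → ℕ→ℚ n ≡ mkℚ (ℤ.+ n) 0 (Coprime.sym (1-coprimeTo n))
ℕ→ℚ≡mkℚ n = ℚₚ.normalize-coprime (Coprime.sym (1-coprimeTo n))

ℕ→ℚ-+ : ∀ m n → ℕ→ℚ (m ℕ.+ n) ≡ ℕ→ℚ m + ℕ→ℚ n
ℕ→ℚ-+ m n = sym (trans (cong₂ _+_ (ℕ→ℚ≡mkℚ m) (ℕ→ℚ≡mkℚ n)) (ℚₚ./-cong {q₁ = 1} {q₂ = 1} m*1+n*1 refl))
  where
  m*1+n*1 : ℤ.+ m ℤ.* ℤ.+ 1 ℤ.+ ℤ.+ n ℤ.* ℤ.+ 1 ≡ ℤ.+ (m ℕ.+ n)
  m*1+n*1 = cong₂ ℤ._+_ (ℤₚ.*-identityʳ (ℤ.+ m)) (ℤₚ.*-identityʳ (ℤ.+ n))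

ℕ→ℚ-* : ∀ m n → ℕ→ℚ (m ℕ.* n) ≡ ℕ→ℚ m * ℕ→ℚ n
ℕ→ℚ-* m n = sym (trans (cong₂ _*_ (ℕ→ℚ≡mkℚ m) (ℕ→ℚ≡mkℚ n))
                       (ℚₚ./-cong {q₁ = 1} {q₂ = 1} (sym (ℤₚ.pos-* m n)) refl))

ℕ→ℚ-suc : ∀ n → ℕ→ℚ (suc n) ≡ 1ℚ + ℕ→ℚ n
ℕ→ℚ-suc = ℕ→ℚ-+ 1

ℕ→ℚ-nonNeg : ∀ n → 0ℚ ≤ ℕ→ℚ n
ℕ→ℚ-nonNeg n = ℚₚ.nonNegative⁻¹ (ℕ→ℚ n) {{ℚₚ.normalize-nonNeg n 1}}

ℕ→ℚ-mono-≤ : ∀ {m n} → m ℕ.≤ n → ℕ→ℚ m ≤ ℕ→ℚ n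
ℕ→ℚ-mono-≤ {m} {n} m≤n = subst (ℕ→ℚ m ≤_) m+[n∸m]≡n (p≤p+q (ℕ→ℚ m) (ℕ→ℚ-nonNeg (n ℕ.∸ m)))
  where
  m+[n∸m]≡n : ℕ→ℚ m + ℕ→ℚ (n ℕ.∸ m) ≡ ℕ→ℚ n
  m+[n∸m]≡n = trans (sym (ℕ→ℚ-+ m (n ℕ.∸ m))) (cong ℕ→ℚ (ℕₚ.m+[n∸m]≡n m≤n))

recip-nonNeg : ∀ n → 0ℚ ≤ recip n
recip-nonNeg zero    = ≤-refl
recip-nonNeg (suc n) = ℚₚ.nonNegative⁻¹ (recip (suc n)) {{ℚₚ.normalize-nonNeg 1 (suc n)}}

ℕ→ℚ*recip : ∀ n → ℕ→ℚ (suc n) * recip (suc n) ≡ 1ℚ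
ℕ→ℚ*recip n = trans (cong₂ _*_ (ℕ→ℚ≡mkℚ (suc n)) (ℚₚ.normalize-coprime (1-coprimeTo (suc n))))
                    (ℚₚ.*-inverseʳ (mkℚ (ℤ.+ suc n) 0 (Coprime.sym (1-coprimeTo (suc n)))))

recip*≤1 : ∀ {t} n → t ≤ ℕ→ℚ n → recip n * t ≤ 1ℚ
recip*≤1 {t} zero    _   = subst (_≤ 1ℚ) (sym (ℚₚ.*-zeroˡ t)) 0≤1
recip*≤1 {t} (suc n) t≤n = ≤-trans (*-monoˡ-≤ (recip (suc n)) (recip-nonNeg (suc n)) t≤n)
                                   (≤-reflexive (trans (ℚₚ.*-comm (recip (suc n)) _) (ℕ→ℚ*recip n)))

ℕ→ℚ≤*recip : ∀ {q M Y} → suc q ℕ.* M ℕ.≤ Y → ℕ→ℚ M ≤ ℕ→ℚ Y * recip (suc q)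
ℕ→ℚ≤*recip {q} {M} {Y} qM≤Y = begin
  ℕ→ℚ M                                  ≡⟨ sym (ℚₚ.*-identityˡ (ℕ→ℚ M)) ⟩
  1ℚ * ℕ→ℚ M                             ≡⟨ cong (_* ℕ→ℚ M) (sym (ℕ→ℚ*recip q)) ⟩
  ℕ→ℚ (suc q) * recip (suc q) * ℕ→ℚ M    ≡⟨ swap (ℕ→ℚ (suc q)) (recip (suc q)) (ℕ→ℚ M) ⟩
  ℕ→ℚ (suc q) * ℕ→ℚ M * recip (suc q)    ≡⟨ cong (_* recip (suc q)) (sym (ℕ→ℚ-* (suc q) M)) ⟩
  ℕ→ℚ (suc q ℕ.* M) * recip (suc q)      ≤⟨ *-monoʳ-≤ (recip (suc q)) (recip-nonNeg (suc q)) (ℕ→ℚ-mono-≤ qM≤Y) ⟩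
  ℕ→ℚ Y * recip (suc q)                  ∎
  where
  open ≤-Reasoning
  swap : ∀ a b c → a * b * c ≡ a * c * b
  swap = solve-∀ ℚ-ring

ℕ→ℚ∣floor∣≤ : ∀ x → 0ℚ ≤ x → ℕ→ℚ ℤ.∣ floor x ∣ ≤ x
ℕ→ℚ∣floor∣≤ (mkℚ ℤ.-[1+ n ] d _) (*≤* ())
ℕ→ℚ∣floor∣≤ x@(mkℚ (ℤ.+ n) d _) _ = subst (_≤ x) (sym ℕ→ℚ∣floor∣≡) (*≤* [n/d]*d≤n*1)
  where
  ∣floor∣≡ : ℤ.∣ floor x ∣ ≡ n ℕ./ suc d
  ∣floor∣≡ = cong ℤ.∣_∣ (ℤ.div-pos-is-/ℕ (ℤ.+ n) (suc d))
  ℕ→ℚ∣floor∣≡ : ℕ→ℚ ℤ.∣ floor x ∣ ≡ mkℚ (ℤ.+ (n ℕ./ suc d)) 0 _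
  ℕ→ℚ∣floor∣≡ = trans (cong ℕ→ℚ ∣floor∣≡) (ℕ→ℚ≡mkℚ (n ℕ./ suc d))
  [n/d]*d≤n*1 : ℤ.+ (n ℕ./ suc d) ℤ.* ℤ.+ suc d ℤ.≤ ℤ.+ n ℤ.* ℤ.+ 1
  [n/d]*d≤n*1 = subst₂ ℤ._≤_ (ℤₚ.pos-* (n ℕ./ suc d) (suc d)) (ℤₚ.pos-* n 1)
                  (ℤ.+≤+ (subst (n ℕ./ suc d ℕ.* suc d ℕ.≤_) (sym (ℕₚ.*-identityʳ n)) (ℕ.m/n*n≤m n (suc d))))

prodℚ : List ℚ → ℚ
prodℚ = foldr _*_ 1ℚ

∑-syntax : ℕ → (ℕ → ℚ) → ℚ
∑-syntax N f = sumℚ (map f (upTo N))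

∏-syntax : ℕ → (ℕ → ℚ) → ℚ
∏-syntax N f = prodℚ (map f (upTo N))

syntax ∑-syntax N (λ k → e) = ∑[ k < N ] e
syntax ∏-syntax N (λ k → e) = ∏[ k < N ] e

sumℚ-++ : ∀ (xs ys : List ℚ) → sumℚ (xs ++ ys) ≡ sumℚ xs + sumℚ ys
sumℚ-++ []       ys = sym (ℚₚ.+-identityˡ (sumℚ ys))
sumℚ-++ (x ∷ xs) ys = trans (cong (x +_) (sumℚ-++ xs ys)) (sym (ℚₚ.+-assoc x (sumℚ xs) (sumℚ ys)))

prodℚ-++ : ∀ (xs ys : List ℚ) → prodℚ (xs ++ ys) ≡ prodℚ xs * prodℚ ys
prodℚ-++ []       ys = sym (ℚₚ.*-identityˡ (prodℚ ys))
prodℚ-++ (x ∷ xs) ys = trans (cong (x *_) (prodℚ-++ xs ys)) (sym (ℚₚ.*-assoc x (prodℚ xs) (prodℚ ys)))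

sumℚ-nonNeg : ∀ {xs : List ℚ} → All (0ℚ ≤_) xs → 0ℚ ≤ sumℚ xs
sumℚ-nonNeg []            = ≤-refl
sumℚ-nonNeg (0≤x ∷ 0≤xs) = +-nonNeg 0≤x (sumℚ-nonNeg 0≤xs)

module _ {A : Set} where

  sumℚ-+ : ∀ (f g : A → ℚ) L → sumℚ (map (λ a → f a + g a) L) ≡ sumℚ (map f L) + sumℚ (map g L)
  sumℚ-+ f g []      = refl
  sumℚ-+ f g (a ∷ L) = trans (cong (f a + g a +_) (sumℚ-+ f g L)) (+-interchange (f a) (g a) _ _)
    where
    +-interchange : ∀ p q r s → p + q + (r + s) ≡ p + r + (q + s)
    +-interchange = solve-∀ ℚ-ring

  sumℚ-*ʳ : ∀ (f : A → ℚ) c L → sumℚ (map (λ a → f a * c) L) ≡ sumℚ (map f L) * c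
  sumℚ-*ʳ f c []      = sym (ℚₚ.*-zeroˡ c)
  sumℚ-*ʳ f c (a ∷ L) = trans (cong (f a * c +_) (sumℚ-*ʳ f c L)) (sym (ℚₚ.*-distribʳ-+ c (f a) (sumℚ (map f L))))

  sumℚ-const : ∀ c (L : List A) → sumℚ (map (λ _ → c) L) ≡ ℕ→ℚ (length L) * c
  sumℚ-const c []      = sym (ℚₚ.*-zeroˡ c)
  sumℚ-const c (a ∷ L) = begin
    c + sumℚ (map (λ _ → c) L)   ≡⟨ cong₂ _+_ (sym (ℚₚ.*-identityˡ c)) (sumℚ-const c L) ⟩
    1ℚ * c + ℕ→ℚ (length L) * c  ≡⟨ sym (ℚₚ.*-distribʳ-+ c 1ℚ (ℕ→ℚ (length L))) ⟩
    (1ℚ + ℕ→ℚ (length L)) * c    ≡⟨ cong (_* c) (sym (ℕ→ℚ-suc (length L))) ⟩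
    ℕ→ℚ (suc (length L)) * c     ∎
    where open ≡-Reasoning

  sumℚ-mono : ∀ {f g : A → ℚ} {L} → All (λ a → f a ≤ g a) L → sumℚ (map f L) ≤ sumℚ (map g L)
  sumℚ-mono []            = ≤-refl
  sumℚ-mono (fa≤ga ∷ f≤g) = +-mono-≤ fa≤ga (sumℚ-mono f≤g)

  prodℚ-nonNeg : ∀ {f : A → ℚ} L → (∀ a → 0ℚ ≤ f a) → 0ℚ ≤ prodℚ (map f L)
  prodℚ-nonNeg []      0≤f = 0≤1
  prodℚ-nonNeg (a ∷ L) 0≤f = *-nonNeg (0≤f a) (prodℚ-nonNeg L 0≤f)

  prodℚ-mono : ∀ {f g : A → ℚ} {L} → (∀ a → 0ℚ ≤ f a) → All (λ a → f a ≤ g a) L →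
               prodℚ (map f L) ≤ prodℚ (map g L)
  prodℚ-mono 0≤f []                      = ≤-refl
  prodℚ-mono {L = a ∷ L} 0≤f (fa≤ga ∷ f≤g) =
    *-mono-≤ (0≤f a) (prodℚ-nonNeg L 0≤f) fa≤ga (prodℚ-mono 0≤f f≤g)

  module _ {P : Pred A 0ℓ} (P? : Decidable P) where

    prodℚ-filter : ∀ (g : A → ℚ) L →
      prodℚ (map (λ a → 1ℚ + g a) (filter P? L)) ≡
      prodℚ (map (λ a → 1ℚ + (if does (P? a) then g a else 0ℚ)) L)
    prodℚ-filter g []      = refl
    prodℚ-filter g (a ∷ L) with P? a
    ... | yes _ = cong ((1ℚ + g a) *_) (prodℚ-filter g L)
    ... | no  _ = trans (prodℚ-filter g L) (sym (trans (cong (_* rest) (ℚₚ.+-identityʳ 1ℚ)) (ℚₚ.*-identityˡ rest)))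
      where rest = prodℚ (map (λ a → 1ℚ + (if does (P? a) then g a else 0ℚ)) L)

    length-filter*≤sum : ∀ {e} {g : A → ℚ} {L} → All (λ a → P a → e ≤ g a) L → All (λ a → 0ℚ ≤ g a) L →
                         ℕ→ℚ (length (filter P? L)) * e ≤ sumℚ (map g L)
    length-filter*≤sum {e} {L = []} [] [] = ≤-reflexive (ℚₚ.*-zeroˡ e)
    length-filter*≤sum {e} {g} {a ∷ L} (Pa⇒e≤ga ∷ e≤g) (0≤ga ∷ 0≤g) with P? a
    ... | yes Pa = begin
      ℕ→ℚ (suc n) * e        ≡⟨ cong (_* e) (ℕ→ℚ-suc n) ⟩
      (1ℚ + ℕ→ℚ n) * e       ≡⟨ ℚₚ.*-distribʳ-+ e 1ℚ (ℕ→ℚ n) ⟩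
      1ℚ * e + ℕ→ℚ n * e     ≡⟨ cong (_+ ℕ→ℚ n * e) (ℚₚ.*-identityˡ e) ⟩
      e + ℕ→ℚ n * e          ≤⟨ +-mono-≤ (Pa⇒e≤ga Pa) (length-filter*≤sum e≤g 0≤g) ⟩
      g a + sumℚ (map g L)   ∎
      where
      open ≤-Reasoning
      n = length (filter P? L)
    ... | no _ = ≤-trans (length-filter*≤sum e≤g 0≤g)
                   (subst (_≤ g a + sumℚ (map g L)) (ℚₚ.+-identityˡ _) (+-monoˡ-≤ (sumℚ (map g L)) 0≤ga))

∑-suc : ∀ (f : ℕ → ℚ) N → ∑[ k < suc N ] f k ≡ ∑[ k < N ] f k + f N
∑-suc f N = begin
  sumℚ (map f (upTo (suc N)))        ≡⟨ cong (sumℚ ∘ map f) (sym (List.upTo-∷ʳ N)) ⟩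
  sumℚ (map f (upTo N ++ [ N ]))     ≡⟨ cong sumℚ (List.map-++ f (upTo N) [ N ]) ⟩
  sumℚ (map f (upTo N) ++ [ f N ])   ≡⟨ sumℚ-++ (map f (upTo N)) [ f N ] ⟩
  ∑[ k < N ] f k + (f N + 0ℚ)        ≡⟨ cong (∑[ k < N ] f k +_) (ℚₚ.+-identityʳ (f N)) ⟩
  ∑[ k < N ] f k + f N               ∎
  where open ≡-Reasoning

∏-suc : ∀ (f : ℕ → ℚ) N → ∏[ k < suc N ] f k ≡ ∏[ k < N ] f k * f N
∏-suc f N = begin
  prodℚ (map f (upTo (suc N)))       ≡⟨ cong (prodℚ ∘ map f) (sym (List.upTo-∷ʳ N)) ⟩
  prodℚ (map f (upTo N ++ [ N ]))    ≡⟨ cong prodℚ (List.map-++ f (upTo N) [ N ]) ⟩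
  prodℚ (map f (upTo N) ++ [ f N ])  ≡⟨ prodℚ-++ (map f (upTo N)) [ f N ] ⟩
  ∏[ k < N ] f k * (f N * 1ℚ)        ≡⟨ cong (∏[ k < N ] f k *_) (ℚₚ.*-identityʳ (f N)) ⟩
  ∏[ k < N ] f k * f N               ∎
  where open ≡-Reasoning

∏-mono-upTo : ∀ (f : ℕ → ℚ) → (∀ k → 1ℚ ≤ f k) → ∀ {M N} → M ℕ.≤ N → ∏[ k < M ] f k ≤ ∏[ k < N ] f k
∏-mono-upTo f 1≤f {M} {zero}  z≤n = ≤-refl
∏-mono-upTo f 1≤f {M} {suc N} M≤1+N with ℕₚ.m≤n⇒m<n∨m≡n M≤1+N
... | inj₂ refl      = ≤-refl
... | inj₁ (s≤s M≤N) = begin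
  ∏[ k < M ] f k         ≤⟨ ∏-mono-upTo f 1≤f M≤N ⟩
  ∏[ k < N ] f k         ≡⟨ sym (ℚₚ.*-identityʳ _) ⟩
  ∏[ k < N ] f k * 1ℚ    ≤⟨ *-monoˡ-≤ _ (prodℚ-nonNeg (upTo N) (λ k → ≤-trans 0≤1 (1≤f k))) (1≤f N) ⟩
  ∏[ k < N ] f k * f N   ≡⟨ sym (∏-suc f N) ⟩
  ∏[ k < suc N ] f k     ∎
  where open ≤-Reasoning

∑-mono-upTo : ∀ (f : ℕ → ℚ) → (∀ k → 0ℚ ≤ f k) → ∀ {M N} → M ℕ.≤ N → ∑[ k < M ] f k ≤ ∑[ k < N ] f k
∑-mono-upTo f 0≤f {M} {zero}  z≤n = ≤-refl
∑-mono-upTo f 0≤f {M} {suc N} M≤1+N with ℕₚ.m≤n⇒m<n∨m≡n M≤1+N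
... | inj₂ refl      = ≤-refl
... | inj₁ (s≤s M≤N) = ≤-trans (∑-mono-upTo f 0≤f M≤N)
  (subst (∑[ k < N ] f k ≤_) (sym (∑-suc f N)) (p≤p+q (∑[ k < N ] f k) (0≤f N)))

-- Partial sums of the exponential series

expTerm-nonNeg : ∀ {y} k → 0ℚ ≤ y → 0ℚ ≤ expTerm y k
expTerm-nonNeg zero    0≤y = 0≤1
expTerm-nonNeg (suc k) 0≤y = *-nonNeg (*-nonNeg (expTerm-nonNeg k 0≤y) 0≤y) (recip-nonNeg (suc k))

expTerm-mono : ∀ {y y′} k → 0ℚ ≤ y → y ≤ y′ → expTerm y k ≤ expTerm y′ k
expTerm-mono zero    0≤y y≤y′ = ≤-refl
expTerm-mono (suc k) 0≤y y≤y′ = *-monoʳ-≤ (recip (suc k)) (recip-nonNeg (suc k))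
  (*-mono-≤ (expTerm-nonNeg k 0≤y) 0≤y (expTerm-mono k 0≤y y≤y′) y≤y′)

ℕ→ℚ*expTerm : ∀ y k → ℕ→ℚ (suc k) * expTerm y (suc k) ≡ expTerm y k * y
ℕ→ℚ*expTerm y k = begin
  n * (expTerm y k * y * recip (suc k))  ≡⟨ reorder n (expTerm y k * y) (recip (suc k)) ⟩
  expTerm y k * y * (n * recip (suc k))  ≡⟨ cong (expTerm y k * y *_) (ℕ→ℚ*recip k) ⟩
  expTerm y k * y * 1ℚ                   ≡⟨ ℚₚ.*-identityʳ (expTerm y k * y) ⟩
  expTerm y k * y                        ∎
  where
  open ≡-Reasoning
  n = ℕ→ℚ (suc k)
  reorder : ∀ n e r → n * (e * r) ≡ e * (n * r)
  reorder = solve-∀ ℚ-ring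

expPartial-nonNeg : ∀ {y} N → 0ℚ ≤ y → 0ℚ ≤ expPartial y N
expPartial-nonNeg N 0≤y = sumℚ-nonNeg (All.map⁺ (All.universal (λ k → expTerm-nonNeg k 0≤y) (upTo N)))

expPartial-mono : ∀ {y y′} N → 0ℚ ≤ y → y ≤ y′ → expPartial y N ≤ expPartial y′ N
expPartial-mono N 0≤y y≤y′ = sumℚ-mono (All.universal (λ k → expTerm-mono k 0≤y y≤y′) (upTo N))

expPartial-0≤1 : ∀ N → expPartial 0ℚ N ≤ 1ℚ
expPartial-0≤1 zero    = 0≤1
expPartial-0≤1 (suc N) = ≤-reflexive (expPartial-0-suc N)
  where
  expPartial-0-suc : ∀ N → expPartial 0ℚ (suc N) ≡ 1ℚ
  expPartial-0-suc zero    = refl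
  expPartial-0-suc (suc N) = begin
    expPartial 0ℚ (suc (suc N))                   ≡⟨ ∑-suc (expTerm 0ℚ) (suc N) ⟩
    expPartial 0ℚ (suc N) + expTerm 0ℚ N * 0ℚ * r ≡⟨ cong₂ _+_ (expPartial-0-suc N) (cong (_* r) (ℚₚ.*-zeroʳ (expTerm 0ℚ N))) ⟩
    1ℚ + 0ℚ * r                                   ≡⟨ cong (1ℚ +_) (ℚₚ.*-zeroˡ r) ⟩
    1ℚ + 0ℚ                                       ≡⟨ ℚₚ.+-identityʳ 1ℚ ⟩
    1ℚ                                            ∎
    where
    open ≡-Reasoning
    r = recip (suc N)

-- Truncation of e^(x+a) − e^x ≤ a e^(x+a), proved termwise.
module _ {x a : ℚ} (0≤x : 0ℚ ≤ x) (0≤a : 0ℚ ≤ a) where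

  private
    A B : ℕ → ℚ
    A = expTerm (x + a)
    B = expTerm x

  expTerm-+-suc≤ : ∀ k → A (suc k) ≤ B (suc k) + a * A k
  expTerm-+-suc≤ zero    = ≤-reflexive (split x a)
    where
    split : ∀ x a → 1ℚ * (x + a) * 1ℚ ≡ 1ℚ * x * 1ℚ + a * 1ℚ
    split = solve-∀ ℚ-ring
  expTerm-+-suc≤ (suc k) = begin
    A (suc k) * (x + a) * r                              ≡⟨ split (A (suc k)) x a r ⟩
    (A (suc k) * x + a * A (suc k)) * r
      ≤⟨ *-monoʳ-≤ r 0≤r (+-monoˡ-≤ (a * A (suc k)) (*-monoʳ-≤ x 0≤x (expTerm-+-suc≤ k))) ⟩
    ((B (suc k) + a * A k) * x + a * A (suc k)) * r      ≡⟨ regroup (B (suc k)) (A k) (A (suc k)) x a r ⟩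
    B (suc k) * x * r + a * r * (A k * x + A (suc k))
      ≤⟨ +-monoʳ-≤ (B (suc k) * x * r) (*-monoˡ-≤ (a * r) (*-nonNeg 0≤a 0≤r)
           (+-monoˡ-≤ (A (suc k)) (*-monoˡ-≤ (A k) (expTerm-nonNeg k 0≤x+a) (p≤p+q x 0≤a)))) ⟩
    B (suc k) * x * r + a * r * (A k * (x + a) + A (suc k))
      ≡⟨ cong (λ z → B (suc k) * x * r + a * r * (z + A (suc k))) (sym (ℕ→ℚ*expTerm (x + a) k)) ⟩
    B (suc k) * x * r + a * r * (n * A (suc k) + A (suc k)) ≡⟨ collect (B (suc k) * x * r) a r n (A (suc k)) ⟩
    B (suc k) * x * r + a * A (suc k) * ((1ℚ + n) * r)
      ≡⟨ cong (λ z → B (suc k) * x * r + a * A (suc k) * (z * r)) (sym (ℕ→ℚ-suc (suc k))) ⟩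
    B (suc k) * x * r + a * A (suc k) * (ℕ→ℚ (suc (suc k)) * r)
      ≡⟨ cong (λ z → B (suc k) * x * r + a * A (suc k) * z) (ℕ→ℚ*recip (suc k)) ⟩
    B (suc k) * x * r + a * A (suc k) * 1ℚ               ≡⟨ cong (B (suc k) * x * r +_) (ℚₚ.*-identityʳ (a * A (suc k))) ⟩
    B (suc k) * x * r + a * A (suc k)                    ∎
    where
    open ≤-Reasoning
    r = recip (suc (suc k))
    n = ℕ→ℚ (suc k)
    0≤r : 0ℚ ≤ r
    0≤r = recip-nonNeg (suc (suc k))
    0≤x+a : 0ℚ ≤ x + a
    0≤x+a = +-nonNeg 0≤x 0≤a
    split : ∀ p x a r → p * (x + a) * r ≡ (p * x + a * p) * r
    split = solve-∀ ℚ-ring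
    regroup : ∀ b p q x a r → ((b + a * p) * x + a * q) * r ≡ b * x * r + a * r * (p * x + q)
    regroup = solve-∀ ℚ-ring
    collect : ∀ c a r n q → c + a * r * (n * q + q) ≡ c + a * q * ((1ℚ + n) * r)
    collect = solve-∀ ℚ-ring

  expPartial-+≤ : ∀ N → expPartial (x + a) N ≤ expPartial x N + a * expPartial (x + a) N
  expPartial-+≤ zero    = ≤-reflexive (sym (trans (cong (0ℚ +_) (ℚₚ.*-zeroʳ a)) (ℚₚ.+-identityˡ 0ℚ)))
  expPartial-+≤ (suc N) = ≤-trans (expPartial-suc≤ N) (+-monoʳ-≤ (expPartial x (suc N)) (*-monoˡ-≤ a 0≤a growing))
    where
    growing : expPartial (x + a) N ≤ expPartial (x + a) (suc N)
    growing = subst (expPartial (x + a) N ≤_) (sym (∑-suc A N))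
                (p≤p+q (expPartial (x + a) N) (expTerm-nonNeg N (+-nonNeg 0≤x 0≤a)))
    expPartial-suc≤ : ∀ N → expPartial (x + a) (suc N) ≤ expPartial x (suc N) + a * expPartial (x + a) N
    expPartial-suc≤ zero    = ≤-reflexive (sym (trans (cong (1ℚ + 0ℚ +_) (ℚₚ.*-zeroʳ a)) (ℚₚ.+-identityʳ (1ℚ + 0ℚ))))
    expPartial-suc≤ (suc N) = begin
      expPartial (x + a) (suc (suc N))                              ≡⟨ ∑-suc A (suc N) ⟩
      expPartial (x + a) (suc N) + A (suc N)                        ≤⟨ +-mono-≤ (expPartial-suc≤ N) (expTerm-+-suc≤ N) ⟩
      (expPartial x (suc N) + a * expPartial (x + a) N) + (B (suc N) + a * A N)
        ≡⟨ interchange (expPartial x (suc N)) (expPartial (x + a) N) (B (suc N)) (A N) a ⟩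
      (expPartial x (suc N) + B (suc N)) + a * (expPartial (x + a) N + A N)
        ≡⟨ sym (cong₂ (λ u v → u + a * v) (∑-suc B (suc N)) (∑-suc A N)) ⟩
      expPartial x (suc (suc N)) + a * expPartial (x + a) (suc N)   ∎
      where
      open ≤-Reasoning
      interchange : ∀ u v w z a → (u + a * v) + (w + a * z) ≡ (u + w) + a * (v + z)
      interchange = solve-∀ ℚ-ring

expPartial-+-half≤ : ∀ {x a} N → 0ℚ ≤ x → 0ℚ ≤ a → a + a ≤ 1ℚ →
                     expPartial (x + a) N ≤ (1ℚ + (a + a)) * expPartial x N
expPartial-+-half≤ {x} {a} N 0≤x 0≤a a+a≤1 = +-cancelʳ-≤ (a * E′ + a * E′) (begin
  E′ + (a * E′ + a * E′)                         ≡⟨ factor E′ a ⟩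
  (1ℚ + (a + a)) * E′                            ≤⟨ *-monoˡ-≤ (1ℚ + (a + a)) 0≤1+2a (expPartial-+≤ 0≤x 0≤a N) ⟩
  (1ℚ + (a + a)) * (E + a * E′)                  ≡⟨ expand E a E′ ⟩
  (1ℚ + (a + a)) * E + a * E′ + (a + a) * (a * E′)
    ≤⟨ +-monoʳ-≤ ((1ℚ + (a + a)) * E + a * E′) (*-monoʳ-≤ (a * E′) 0≤aE′ a+a≤1) ⟩
  (1ℚ + (a + a)) * E + a * E′ + 1ℚ * (a * E′)    ≡⟨ regroup ((1ℚ + (a + a)) * E) (a * E′) ⟩
  (1ℚ + (a + a)) * E + (a * E′ + a * E′)         ∎)
  where
  open ≤-Reasoning
  E′ = expPartial (x + a) N
  E  = expPartial x N
  0≤1+2a : 0ℚ ≤ 1ℚ + (a + a)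
  0≤1+2a = +-nonNeg 0≤1 (+-nonNeg 0≤a 0≤a)
  0≤aE′ : 0ℚ ≤ a * E′
  0≤aE′ = *-nonNeg 0≤a (expPartial-nonNeg N (+-nonNeg 0≤x 0≤a))
  factor : ∀ E a → E + (a * E + a * E) ≡ (1ℚ + (a + a)) * E
  factor = solve-∀ ℚ-ring
  expand : ∀ E a E′ → (1ℚ + (a + a)) * (E + a * E′) ≡ (1ℚ + (a + a)) * E + a * E′ + (a + a) * (a * E′)
  expand = solve-∀ ℚ-ring
  regroup : ∀ u v → u + v + 1ℚ * v ≡ u + (v + v)
  regroup = solve-∀ ℚ-ring

expPartial-+-*≤ : ∀ {x b} N j → 0ℚ ≤ x → 0ℚ ≤ b → b + b ≤ 1ℚ →
                  expPartial (x + ℕ→ℚ j * b) N ≤ (1ℚ + (b + b)) ^ j * expPartial x N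
expPartial-+-*≤ {x} {b} N zero 0≤x 0≤b b+b≤1 = ≤-reflexive (begin
  expPartial (x + 0ℚ * b) N  ≡⟨ cong (λ y → expPartial y N) (x+0*b≡x x b) ⟩
  expPartial x N             ≡⟨ sym (ℚₚ.*-identityˡ (expPartial x N)) ⟩
  1ℚ * expPartial x N        ∎)
  where
  open ≡-Reasoning
  x+0*b≡x : ∀ x b → x + 0ℚ * b ≡ x
  x+0*b≡x = solve-∀ ℚ-ring
expPartial-+-*≤ {x} {b} N (suc j) 0≤x 0≤b b+b≤1 = begin
  expPartial (x + ℕ→ℚ (suc j) * b) N           ≡⟨ cong (λ y → expPartial y N) x+[1+j]b≡x+jb+b ⟩
  expPartial ((x + ℕ→ℚ j * b) + b) N           ≤⟨ expPartial-+-half≤ N 0≤x+jb 0≤b b+b≤1 ⟩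
  c * expPartial (x + ℕ→ℚ j * b) N             ≤⟨ *-monoˡ-≤ c 0≤c (expPartial-+-*≤ N j 0≤x 0≤b b+b≤1) ⟩
  c * (c ^ j * expPartial x N)                 ≡⟨ sym (ℚₚ.*-assoc c (c ^ j) (expPartial x N)) ⟩
  c ^ suc j * expPartial x N                   ∎
  where
  open ≤-Reasoning
  c = 1ℚ + (b + b)
  0≤c : 0ℚ ≤ c
  0≤c = +-nonNeg 0≤1 (+-nonNeg 0≤b 0≤b)
  0≤x+jb : 0ℚ ≤ x + ℕ→ℚ j * b
  0≤x+jb = +-nonNeg 0≤x (*-nonNeg (ℕ→ℚ-nonNeg j) 0≤b)
  shift : ∀ x n b → x + (1ℚ + n) * b ≡ (x + n * b) + b
  shift = solve-∀ ℚ-ring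
  x+[1+j]b≡x+jb+b : x + ℕ→ℚ (suc j) * b ≡ (x + ℕ→ℚ j * b) + b
  x+[1+j]b≡x+jb+b = trans (cong (λ n → x + n * b) (ℕ→ℚ-suc j)) (shift x (ℕ→ℚ j) b)

[1+v]^j≤2^j : ∀ {v} j → 0ℚ ≤ v → v ≤ 1ℚ → (1ℚ + v) ^ j ≤ ℕ→ℚ (2 ℕ.^ j)
[1+v]^j≤2^j zero    0≤v v≤1 = ≤-refl
[1+v]^j≤2^j {v} (suc j) 0≤v v≤1 = begin
  (1ℚ + v) * (1ℚ + v) ^ j        ≤⟨ *-mono-≤ (+-nonNeg 0≤1 0≤v) (^-nonNeg j (+-nonNeg 0≤1 0≤v))
                                      (+-monoʳ-≤ 1ℚ v≤1) ([1+v]^j≤2^j j 0≤v v≤1) ⟩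
  ℕ→ℚ 2 * ℕ→ℚ (2 ℕ.^ j)          ≡⟨ sym (ℕ→ℚ-* 2 (2 ℕ.^ j)) ⟩
  ℕ→ℚ (2 ℕ.^ suc j)              ∎
  where open ≤-Reasoning

-- The summand v turns (1 + v)^j ≤ 1 + 2^j v into a statement that survives induction on j.
[1+v]^j+v≤1+2^j*v : ∀ {v} j → 0ℚ ≤ v → v ≤ 1ℚ → (1ℚ + v) ^ j + v ≤ 1ℚ + ℕ→ℚ (2 ℕ.^ j) * v
[1+v]^j+v≤1+2^j*v {v} zero    0≤v v≤1 = ≤-reflexive (cong (1ℚ +_) (sym (ℚₚ.*-identityˡ v)))
[1+v]^j+v≤1+2^j*v {v} (suc j) 0≤v v≤1 = begin
  (1ℚ + v) * P + v               ≡⟨ expand P v ⟩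
  (P + v) + v * P                ≤⟨ +-mono-≤ ([1+v]^j+v≤1+2^j*v j 0≤v v≤1) (*-monoˡ-≤ v 0≤v ([1+v]^j≤2^j j 0≤v v≤1)) ⟩
  (1ℚ + T * v) + v * T           ≡⟨ collect T v ⟩
  1ℚ + (ℕ→ℚ 2 * T) * v           ≡⟨ cong (λ z → 1ℚ + z * v) (sym (ℕ→ℚ-* 2 (2 ℕ.^ j))) ⟩
  1ℚ + ℕ→ℚ (2 ℕ.^ suc j) * v     ∎
  where
  open ≤-Reasoning
  P = (1ℚ + v) ^ j
  T = ℕ→ℚ (2 ℕ.^ j)
  expand : ∀ P v → (1ℚ + v) * P + v ≡ (P + v) + v * P
  expand = solve-∀ ℚ-ring
  collect : ∀ T v → (1ℚ + T * v) + v * T ≡ 1ℚ + ((1ℚ + 1ℚ) * T) * v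
  collect = solve-∀ ℚ-ring

[1+v]^j≤1+2^j*v : ∀ {v} j → 0ℚ ≤ v → v ≤ 1ℚ → (1ℚ + v) ^ j ≤ 1ℚ + ℕ→ℚ (2 ℕ.^ j) * v
[1+v]^j≤1+2^j*v {v} j 0≤v v≤1 = ≤-trans (p≤p+q ((1ℚ + v) ^ j) 0≤v) ([1+v]^j+v≤1+2^j*v j 0≤v v≤1)

-- Opaque, so that 2 ^ (9 K) stays a stuck term rather than an astronomically large rational.
opaque
  K : ℕ
  K = 2 ℕ.^ 200

opaque
  unfolding K
  K≡2^200 : K ≡ 2 ℕ.^ 200
  K≡2^200 = refl

expPartial-+-100*≤ : ∀ {x u} N → 0ℚ ≤ x → 0ℚ ≤ u → u ≤ 1ℚ →
                     expPartial (x + ℕ→ℚ 100 * u) N ≤ (1ℚ + ℕ→ℚ K * u) * expPartial x N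
expPartial-+-100*≤ {x} {u} N 0≤x 0≤u u≤1 = begin
  expPartial (x + ℕ→ℚ 100 * u) N          ≡⟨ cong (λ y → expPartial (x + y) N) (sym 200*b≡100*u) ⟩
  expPartial (x + ℕ→ℚ 200 * b) N          ≤⟨ expPartial-+-*≤ N 200 0≤x 0≤b (subst (_≤ 1ℚ) (sym b+b≡u) u≤1) ⟩
  (1ℚ + (b + b)) ^ 200 * expPartial x N   ≡⟨ cong (λ v → (1ℚ + v) ^ 200 * expPartial x N) b+b≡u ⟩
  (1ℚ + u) ^ 200 * expPartial x N         ≤⟨ *-monoʳ-≤ (expPartial x N) (expPartial-nonNeg N 0≤x) ([1+v]^j≤1+2^j*v 200 0≤u u≤1) ⟩
  (1ℚ + ℕ→ℚ (2 ℕ.^ 200) * u) * expPartial x N ≡⟨ cong (λ k → (1ℚ + ℕ→ℚ k * u) * expPartial x N) (sym K≡2^200) ⟩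
  (1ℚ + ℕ→ℚ K * u) * expPartial x N       ∎
  where
  open ≤-Reasoning
  b = u * ½
  0≤b : 0ℚ ≤ b
  0≤b = *-nonNeg 0≤u (ℚₚ.≤ᵇ⇒≤ _)
  halves : ∀ u h → u * h + u * h ≡ u * (h + h)
  halves = solve-∀ ℚ-ring
  b+b≡u : b + b ≡ u
  b+b≡u = trans (halves u ½) (ℚₚ.*-identityʳ u)
  reorder : ∀ n u h → n * (u * h) ≡ (n * h) * u
  reorder = solve-∀ ℚ-ring
  200*b≡100*u : ℕ→ℚ 200 * b ≡ ℕ→ℚ 100 * u
  200*b≡100*u = reorder (ℕ→ℚ 200) u ½

expPartial-100*sum≤prod : ∀ N (us : List ℚ) → All (λ u → 0ℚ ≤ u × u ≤ 1ℚ) us →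
                          expPartial (ℕ→ℚ 100 * sumℚ us) N ≤ prodℚ (map (λ u → 1ℚ + ℕ→ℚ K * u) us)
expPartial-100*sum≤prod N []       []                  = expPartial-0≤1 N
expPartial-100*sum≤prod N (u ∷ us) ((0≤u , u≤1) ∷ us∈[0,1]) = begin
  expPartial (ℕ→ℚ 100 * (u + sumℚ us)) N             ≡⟨ cong (λ y → expPartial y N) (distrib (ℕ→ℚ 100) u (sumℚ us)) ⟩
  expPartial (ℕ→ℚ 100 * sumℚ us + ℕ→ℚ 100 * u) N    ≤⟨ expPartial-+-100*≤ N 0≤100Σ 0≤u u≤1 ⟩
  (1ℚ + ℕ→ℚ K * u) * expPartial (ℕ→ℚ 100 * sumℚ us) N
    ≤⟨ *-monoˡ-≤ (1ℚ + ℕ→ℚ K * u) (+-nonNeg 0≤1 (*-nonNeg (ℕ→ℚ-nonNeg K) 0≤u)) (expPartial-100*sum≤prod N us us∈[0,1]) ⟩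
  (1ℚ + ℕ→ℚ K * u) * prodℚ (map (λ u → 1ℚ + ℕ→ℚ K * u) us) ∎
  where
  open ≤-Reasoning
  distrib : ∀ c u s → c * (u + s) ≡ c * s + c * u
  distrib = solve-∀ ℚ-ring
  0≤100Σ : 0ℚ ≤ ℕ→ℚ 100 * sumℚ us
  0≤100Σ = *-nonNeg (ℕ→ℚ-nonNeg 100) (sumℚ-nonNeg (All.map proj₁ us∈[0,1]))

-- Sums of divisor products

∑-multiples≤ : ∀ q (h : ℕ → ℚ) → (∀ n → 0ℚ ≤ h n) → ∀ Y →
  ∃[ M ] (suc q ℕ.* M ℕ.≤ Y ×
          ∑[ k < Y ] (if does (suc q ∣? suc k) then h (suc k) else 0ℚ) ≤ ∑[ j < M ] h (suc q ℕ.* suc j))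
∑-multiples≤ q h 0≤h zero = 0 , ℕₚ.≤-reflexive (ℕₚ.*-zeroʳ (suc q)) , ≤-refl
∑-multiples≤ q h 0≤h (suc Y) with ∑-multiples≤ q h 0≤h Y | suc q ∣? suc Y
... | M , qM≤Y , ∑F≤ | no q∤1+Y = M , ℕₚ.m≤n⇒m≤1+n qM≤Y , (begin
  ∑[ k < suc Y ] F k                    ≡⟨ ∑-suc F Y ⟩
  ∑[ k < Y ] F k + F Y                  ≡⟨ cong (λ b → ∑[ k < Y ] F k + (if b then h (suc Y) else 0ℚ)) (dec-false (suc q ∣? suc Y) q∤1+Y) ⟩
  ∑[ k < Y ] F k + 0ℚ                   ≡⟨ ℚₚ.+-identityʳ _ ⟩
  ∑[ k < Y ] F k                        ≤⟨ ∑F≤ ⟩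
  ∑[ j < M ] G j                        ∎)
  where
  open ≤-Reasoning
  F = λ k → if does (suc q ∣? suc k) then h (suc k) else 0ℚ
  G = λ j → h (suc q ℕ.* suc j)
... | M , qM≤Y , ∑F≤ | yes (divides zero ())
... | M , qM≤Y , ∑F≤ | yes q∣1+Y@(divides (suc j) 1+Y≡[1+j]q) = suc j , ℕₚ.≤-reflexive q[1+j]≡1+Y , (begin
  ∑[ k < suc Y ] F k                    ≡⟨ ∑-suc F Y ⟩
  ∑[ k < Y ] F k + F Y                  ≡⟨ cong (λ b → ∑[ k < Y ] F k + (if b then h (suc Y) else 0ℚ)) (dec-true (suc q ∣? suc Y) q∣1+Y) ⟩
  ∑[ k < Y ] F k + h (suc Y)            ≤⟨ +-mono-≤ (≤-trans ∑F≤ (∑-mono-upTo G (λ i → 0≤h _) M≤j)) (≤-reflexive (cong h (sym q[1+j]≡1+Y))) ⟩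
  ∑[ i < j ] G i + G j                  ≡⟨ sym (∑-suc G j) ⟩
  ∑[ i < suc j ] G i                    ∎)
  where
  open ≤-Reasoning
  F = λ k → if does (suc q ∣? suc k) then h (suc k) else 0ℚ
  G = λ j → h (suc q ℕ.* suc j)
  q[1+j]≡1+Y : suc q ℕ.* suc j ≡ suc Y
  q[1+j]≡1+Y = trans (ℕₚ.*-comm (suc q) (suc j)) (sym 1+Y≡[1+j]q)
  M≤j : M ℕ.≤ j
  M≤j = ℕₚ.≤-pred (ℕₚ.*-cancelˡ-< (suc q) M (suc j) (subst (suc q ℕ.* M ℕ.<_) (sym q[1+j]≡1+Y) (s≤s qM≤Y)))

divisorProduct : (ℕ → ℚ) → ℕ → ℕ → ℚ
divisorProduct w X n = ∏[ m < X ] (1ℚ + (if does (m ∣? n) then w m else 0ℚ))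

eulerProduct : (ℕ → ℚ) → ℕ → ℚ
eulerProduct w X = ∏[ m < X ] (1ℚ + w m * recip m)

module _ {w : ℕ → ℚ} (0≤w : ∀ m → 0ℚ ≤ w m) where

  divisorFactor-nonNeg : ∀ n m → 0ℚ ≤ 1ℚ + (if does (m ∣? n) then w m else 0ℚ)
  divisorFactor-nonNeg n m = +-nonNeg 0≤1 (if-nonNeg (does (m ∣? n)) (0≤w m))

  divisorProduct-nonNeg : ∀ X n → 0ℚ ≤ divisorProduct w X n
  divisorProduct-nonNeg X n = prodℚ-nonNeg (upTo X) (divisorFactor-nonNeg n)

  divisorProduct-suc : ∀ X n → divisorProduct w (suc X) n ≡
                       divisorProduct w X n + (if does (X ∣? n) then divisorProduct w X n else 0ℚ) * w X
  divisorProduct-suc X n = trans (∏-suc _ X) (split (does (X ∣? n)) (divisorProduct w X n))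
    where
    split : ∀ b D → D * (1ℚ + (if b then w X else 0ℚ)) ≡ D + (if b then D else 0ℚ) * w X
    split true  D = distrib D (w X)
      where
      distrib : ∀ D v → D * (1ℚ + v) ≡ D + D * v
      distrib = solve-∀ ℚ-ring
    split false D = trivial D (w X)
      where
      trivial : ∀ D v → D * (1ℚ + 0ℚ) ≡ D + 0ℚ * v
      trivial = solve-∀ ℚ-ring

  eulerProduct-nonNeg : ∀ X → 0ℚ ≤ eulerProduct w X
  eulerProduct-nonNeg X = prodℚ-nonNeg (upTo X) (λ m → +-nonNeg 0≤1 (*-nonNeg (0≤w m) (recip-nonNeg m)))

  module _ (w-prime : ∀ m → Prime m ⊎ w m ≡ 0ℚ) where

    divisorProduct-prime*≤ : ∀ {q} j → Prime q → divisorProduct w q (q ℕ.* j) ≤ divisorProduct w q j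
    divisorProduct-prime*≤ {q} j q-prime =
      prodℚ-mono (divisorFactor-nonNeg (q ℕ.* j)) (All.map factor≤ (All.all-upTo q))
      where
      factor≤ : ∀ {m} → m ℕ.< q →
                1ℚ + (if does (m ∣? (q ℕ.* j)) then w m else 0ℚ) ≤ 1ℚ + (if does (m ∣? j) then w m else 0ℚ)
      factor≤ {m} m<q with m ∣? (q ℕ.* j) | w-prime m
      ... | no _     | _           = +-monoʳ-≤ 1ℚ (if-nonNeg (does (m ∣? j)) (0≤w m))
      ... | yes _    | inj₂ wm≡0   =
        +-monoʳ-≤ 1ℚ (subst (_≤ (if does (m ∣? j) then w m else 0ℚ)) (sym wm≡0) (if-nonNeg (does (m ∣? j)) (0≤w m)))
      ... | yes m∣qj | inj₁ m-prime =
        ≤-reflexive (cong (λ b → 1ℚ + (if b then w m else 0ℚ)) (sym (dec-true (m ∣? j) m∣j)))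
        where
        m∤q : ¬ m ∣ q
        m∤q m∣q with prime⇒irreducible q-prime m∣q
        ... | inj₁ refl = ¬prime[1] m-prime
        ... | inj₂ refl = ℕₚ.<-irrefl refl m<q
        m∣j : m ∣ j
        m∣j with euclidsLemma q j m-prime m∣qj
        ... | inj₁ m∣q = ⊥-elim (m∤q m∣q)
        ... | inj₂ m∣j = m∣j

    ∑-multiples-divisorProduct≤ : ∀ {q} → Prime q → (∀ Y → ∑[ k < Y ] divisorProduct w q (suc k) ≤ ℕ→ℚ Y * eulerProduct w q) →
      ∀ Y → ∑[ k < Y ] (if does (q ∣? suc k) then divisorProduct w q (suc k) else 0ℚ) ≤ ℕ→ℚ Y * recip q * eulerProduct w q
    ∑-multiples-divisorProduct≤ {zero}  0-prime _ _ = ⊥-elim (¬prime[0] 0-prime)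
    ∑-multiples-divisorProduct≤ {suc q} q-prime ∑D≤ Y with ∑-multiples≤ q (divisorProduct w (suc q)) (divisorProduct-nonNeg (suc q)) Y
    ... | M , qM≤Y , ∑F≤ = begin
      ∑[ k < Y ] (if does (suc q ∣? suc k) then D (suc k) else 0ℚ) ≤⟨ ∑F≤ ⟩
      ∑[ j < M ] D (suc q ℕ.* suc j)    ≤⟨ sumℚ-mono (All.universal (λ j → divisorProduct-prime*≤ (suc j) q-prime) (upTo M)) ⟩
      ∑[ j < M ] D (suc j)              ≤⟨ ∑D≤ M ⟩
      ℕ→ℚ M * E                         ≤⟨ *-monoʳ-≤ E (eulerProduct-nonNeg (suc q)) (ℕ→ℚ≤*recip {q} qM≤Y) ⟩
      ℕ→ℚ Y * recip (suc q) * E         ∎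
      where
      open ≤-Reasoning
      D = divisorProduct w (suc q)
      E = eulerProduct w (suc q)

    ∑-divisorProduct≤ : ∀ X Y → ∑[ k < Y ] divisorProduct w X (suc k) ≤ ℕ→ℚ Y * eulerProduct w X
    ∑-divisorProduct≤ zero    Y = ≤-reflexive (trans (sumℚ-const 1ℚ (upTo Y)) (cong (λ n → ℕ→ℚ n * 1ℚ) (List.length-upTo Y)))
    ∑-divisorProduct≤ (suc X) Y = begin
      ∑[ k < Y ] D (suc X) (suc k)
        ≡⟨ cong sumℚ (List.map-cong (λ k → divisorProduct-suc X (suc k)) (upTo Y)) ⟩
      ∑[ k < Y ] (D X (suc k) + F k * w X)
        ≡⟨ sumℚ-+ (λ k → D X (suc k)) (λ k → F k * w X) (upTo Y) ⟩
      ∑[ k < Y ] D X (suc k) + ∑[ k < Y ] (F k * w X)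
        ≡⟨ cong (∑[ k < Y ] D X (suc k) +_) (sumℚ-*ʳ F (w X) (upTo Y)) ⟩
      ∑[ k < Y ] D X (suc k) + (∑[ k < Y ] F k) * w X
        ≤⟨ +-mono-≤ (∑-divisorProduct≤ X Y) multiples≤ ⟩
      ℕ→ℚ Y * E X + ℕ→ℚ Y * recip X * E X * w X
        ≡⟨ factor (ℕ→ℚ Y) (E X) (recip X) (w X) ⟩
      ℕ→ℚ Y * (E X * (1ℚ + w X * recip X))
        ≡⟨ cong (ℕ→ℚ Y *_) (sym (∏-suc (λ m → 1ℚ + w m * recip m) X)) ⟩
      ℕ→ℚ Y * E (suc X) ∎
      where
      open ≤-Reasoning
      D = divisorProduct w
      E = eulerProduct w
      F = λ k → if does (X ∣? suc k) then D X (suc k) else 0ℚ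
      factor : ∀ y e r v → y * e + y * r * e * v ≡ y * (e * (1ℚ + v * r))
      factor = solve-∀ ℚ-ring
      multiples≤ : (∑[ k < Y ] F k) * w X ≤ ℕ→ℚ Y * recip X * E X * w X
      multiples≤ with w-prime X
      ... | inj₁ X-prime = *-monoʳ-≤ (w X) (0≤w X) (∑-multiples-divisorProduct≤ X-prime (∑-divisorProduct≤ X) Y)
      ... | inj₂ wX≡0    = ≤-reflexive (trans (times0 (∑[ k < Y ] F k)) (sym (times0 (ℕ→ℚ Y * recip X * E X))))
        where
        times0 : ∀ p → p * w X ≡ 0ℚ
        times0 p = trans (cong (p *_) wX≡0) (ℚₚ.*-zeroʳ p)

-- Euler products

A^J*[A+d+Jd]≤[A+d]^J*[A+d] : ∀ {A d} J → 0ℚ ≤ A → 0ℚ ≤ d → A ^ J * (A + d + ℕ→ℚ J * d) ≤ (A + d) ^ J * (A + d)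
A^J*[A+d+Jd]≤[A+d]^J*[A+d] {A} {d} zero 0≤A 0≤d = ≤-reflexive (drop-0*d A d)
  where
  drop-0*d : ∀ A d → 1ℚ * (A + d + 0ℚ * d) ≡ 1ℚ * (A + d)
  drop-0*d = solve-∀ ℚ-ring
A^J*[A+d+Jd]≤[A+d]^J*[A+d] {A} {d} (suc J) 0≤A 0≤d = begin
  A * A ^ J * (A + d + ℕ→ℚ (suc J) * d)          ≡⟨ cong (λ n → A * A ^ J * (A + d + n * d)) (ℕ→ℚ-suc J) ⟩
  A * A ^ J * (A + d + (1ℚ + n) * d)             ≡⟨ reorder (A ^ J) A d n ⟩
  A ^ J * (A * (A + d + (1ℚ + n) * d))           ≤⟨ *-monoˡ-≤ (A ^ J) (^-nonNeg J 0≤A) (p≤p+q _ 0≤[1+n]dd) ⟩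
  A ^ J * (A * (A + d + (1ℚ + n) * d) + (1ℚ + n) * d * d) ≡⟨ factor (A ^ J) A d n ⟩
  A ^ J * (A + d + n * d) * (A + d)              ≤⟨ *-monoʳ-≤ (A + d) (+-nonNeg 0≤A 0≤d) (A^J*[A+d+Jd]≤[A+d]^J*[A+d] J 0≤A 0≤d) ⟩
  (A + d) ^ J * (A + d) * (A + d)                ≡⟨ swap ((A + d) ^ J) (A + d) ⟩
  (A + d) * (A + d) ^ J * (A + d)                ∎
  where
  open ≤-Reasoning
  n = ℕ→ℚ J
  0≤[1+n]dd : 0ℚ ≤ (1ℚ + n) * d * d
  0≤[1+n]dd = *-nonNeg (*-nonNeg (+-nonNeg 0≤1 (ℕ→ℚ-nonNeg J)) 0≤d) 0≤d
  reorder : ∀ p A d n → A * p * (A + d + (1ℚ + n) * d) ≡ p * (A * (A + d + (1ℚ + n) * d))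
  reorder = solve-∀ ℚ-ring
  factor : ∀ p A d n → p * (A * (A + d + (1ℚ + n) * d) + (1ℚ + n) * d * d) ≡ p * (A + d + n * d) * (A + d)
  factor = solve-∀ ℚ-ring
  swap : ∀ p a → p * a * a ≡ a * p * a
  swap = solve-∀ ℚ-ring

[1+v]*A^J≤[A+d]^J : ∀ {A d v} J → 0ℚ ≤ A → 0ℚ < d → v * (A + d) ≤ ℕ→ℚ J * d → (1ℚ + v) * A ^ J ≤ (A + d) ^ J
[1+v]*A^J≤[A+d]^J {A} {d} {v} J 0≤A 0<d v[A+d]≤Jd = *-cancelʳ-≤ (A + d) 0<A+d (begin
  (1ℚ + v) * A ^ J * (A + d)           ≡⟨ expand v (A ^ J) (A + d) ⟩
  A ^ J * (A + d + v * (A + d))        ≤⟨ *-monoˡ-≤ (A ^ J) (^-nonNeg J 0≤A) (+-monoʳ-≤ (A + d) v[A+d]≤Jd) ⟩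
  A ^ J * (A + d + ℕ→ℚ J * d)          ≤⟨ A^J*[A+d+Jd]≤[A+d]^J*[A+d] J 0≤A (<⇒≤ 0<d) ⟩
  (A + d) ^ J * (A + d)                ∎)
  where
  open ≤-Reasoning
  0<A+d : 0ℚ < A + d
  0<A+d = ℚₚ.+-mono-≤-< 0≤A 0<d
  expand : ∀ v p B → (1ℚ + v) * p * B ≡ p * (B + v * B)
  expand = solve-∀ ℚ-ring

module _ {v : ℕ → ℚ} {t : ℚ} (J : ℕ) (0<t : 0ℚ < t) (0≤v : ∀ m → 0ℚ ≤ v m)
         (v-bound : ∀ m → v m * ((1ℚ + ℕ→ℚ m + t) * (ℕ→ℚ m + (t + t))) ≤ ℕ→ℚ J * t) where

  private
    0≤t : 0ℚ ≤ t
    0≤t = <⇒≤ 0<t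

    0<x+2t : ∀ X → 0ℚ < (ℕ→ℚ X + (t + t)) ^ J
    0<x+2t X = ^-pos J (ℚₚ.+-mono-≤-< (ℕ→ℚ-nonNeg X) (ℚₚ.+-mono-< 0<t 0<t))

  -- The factor 1 + v X is absorbed by the ratio ((X + 1 + t)(X + 2t) / ((X + t)(X + 1 + 2t)))^J, which telescopes.
  ∏[1+v]*[X+2t]^J≤2^J*[X+t]^J : ∀ X → ∏[ m < X ] (1ℚ + v m) * (ℕ→ℚ X + (t + t)) ^ J ≤ ℕ→ℚ 2 ^ J * (ℕ→ℚ X + t) ^ J
  ∏[1+v]*[X+2t]^J≤2^J*[X+t]^J zero = ≤-reflexive (begin
    1ℚ * (0ℚ + (t + t)) ^ J          ≡⟨ ℚₚ.*-identityˡ ((0ℚ + (t + t)) ^ J) ⟩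
    (0ℚ + (t + t)) ^ J               ≡⟨ cong (λ y → y ^ J) (double t) ⟩
    (ℕ→ℚ 2 * (0ℚ + t)) ^ J           ≡⟨ ^-distrib-* (ℕ→ℚ 2) (0ℚ + t) J ⟩
    ℕ→ℚ 2 ^ J * (0ℚ + t) ^ J         ∎)
    where
    open ≡-Reasoning
    double : ∀ t → 0ℚ + (t + t) ≡ (1ℚ + 1ℚ) * (0ℚ + t)
    double = solve-∀ ℚ-ring
  ∏[1+v]*[X+2t]^J≤2^J*[X+t]^J (suc X) = *-cancelʳ-≤ ((x + (t + t)) ^ J) (0<x+2t X) (begin
    ∏[ m < suc X ] (1ℚ + v m) * (x₁ + (t + t)) ^ J * (x + (t + t)) ^ J
      ≡⟨ cong (λ p → p * (x₁ + (t + t)) ^ J * (x + (t + t)) ^ J) (∏-suc (λ m → 1ℚ + v m) X) ⟩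
    P * (1ℚ + v X) * (x₁ + (t + t)) ^ J * (x + (t + t)) ^ J
      ≡⟨ regroup P (1ℚ + v X) ((x₁ + (t + t)) ^ J) ((x + (t + t)) ^ J) ⟩
    (P * (x + (t + t)) ^ J) * ((1ℚ + v X) * (x₁ + (t + t)) ^ J)
      ≤⟨ *-monoʳ-≤ ((1ℚ + v X) * (x₁ + (t + t)) ^ J) (*-nonNeg (+-nonNeg 0≤1 (0≤v X)) (^-nonNeg J 0≤x₁+2t))
           (∏[1+v]*[X+2t]^J≤2^J*[X+t]^J X) ⟩
    (ℕ→ℚ 2 ^ J * (x + t) ^ J) * ((1ℚ + v X) * (x₁ + (t + t)) ^ J)
      ≡⟨ regroup′ (ℕ→ℚ 2 ^ J) ((x + t) ^ J) (1ℚ + v X) ((x₁ + (t + t)) ^ J) ⟩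
    ℕ→ℚ 2 ^ J * ((1ℚ + v X) * ((x₁ + (t + t)) ^ J * (x + t) ^ J))
      ≡⟨ cong (λ y → ℕ→ℚ 2 ^ J * ((1ℚ + v X) * y)) (sym (^-distrib-* (x₁ + (t + t)) (x + t) J)) ⟩
    ℕ→ℚ 2 ^ J * ((1ℚ + v X) * ((x₁ + (t + t)) * (x + t)) ^ J)
      ≤⟨ *-monoˡ-≤ (ℕ→ℚ 2 ^ J) (^-nonNeg J (ℕ→ℚ-nonNeg 2)) ([1+v]*A^J≤[A+d]^J {v = v X} J 0≤A 0<t v[A+t]≤Jt) ⟩
    ℕ→ℚ 2 ^ J * ((x₁ + (t + t)) * (x + t) + t) ^ J
      ≡⟨ cong (λ y → ℕ→ℚ 2 ^ J * y ^ J) (trans A+t≡ (cong (λ y → (y + t) * (x + (t + t))) (sym (ℕ→ℚ-suc X)))) ⟩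
    ℕ→ℚ 2 ^ J * ((x₁ + t) * (x + (t + t))) ^ J
      ≡⟨ cong (ℕ→ℚ 2 ^ J *_) (^-distrib-* (x₁ + t) (x + (t + t)) J) ⟩
    ℕ→ℚ 2 ^ J * ((x₁ + t) ^ J * (x + (t + t)) ^ J)
      ≡⟨ sym (ℚₚ.*-assoc (ℕ→ℚ 2 ^ J) ((x₁ + t) ^ J) ((x + (t + t)) ^ J)) ⟩
    ℕ→ℚ 2 ^ J * (x₁ + t) ^ J * (x + (t + t)) ^ J ∎)
    where
    open ≤-Reasoning
    x  = ℕ→ℚ X
    x₁ = ℕ→ℚ (suc X)
    P  = ∏[ m < X ] (1ℚ + v m)
    0≤x₁+2t : 0ℚ ≤ x₁ + (t + t)
    0≤x₁+2t = +-nonNeg (ℕ→ℚ-nonNeg (suc X)) (+-nonNeg 0≤t 0≤t)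
    0≤A : 0ℚ ≤ (x₁ + (t + t)) * (x + t)
    0≤A = *-nonNeg 0≤x₁+2t (+-nonNeg (ℕ→ℚ-nonNeg X) 0≤t)
    telescope : ∀ x t → (1ℚ + x + (t + t)) * (x + t) + t ≡ (1ℚ + x + t) * (x + (t + t))
    telescope = solve-∀ ℚ-ring
    A+t≡ : (x₁ + (t + t)) * (x + t) + t ≡ (1ℚ + x + t) * (x + (t + t))
    A+t≡ = subst (λ y → (y + (t + t)) * (x + t) + t ≡ (1ℚ + x + t) * (x + (t + t))) (sym (ℕ→ℚ-suc X)) (telescope x t)
    v[A+t]≤Jt : v X * ((x₁ + (t + t)) * (x + t) + t) ≤ ℕ→ℚ J * t
    v[A+t]≤Jt = subst (λ y → v X * y ≤ ℕ→ℚ J * t) (sym A+t≡) (v-bound X)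
    regroup : ∀ p u a b → p * u * a * b ≡ (p * b) * (u * a)
    regroup = solve-∀ ℚ-ring
    regroup′ : ∀ c d u a → (c * d) * (u * a) ≡ c * (u * (a * d))
    regroup′ = solve-∀ ℚ-ring

  ∏[1+v]≤2^J : ∀ X → ∏[ m < X ] (1ℚ + v m) ≤ ℕ→ℚ 2 ^ J
  ∏[1+v]≤2^J X = *-cancelʳ-≤ ((ℕ→ℚ X + (t + t)) ^ J) (0<x+2t X) (begin
    ∏[ m < X ] (1ℚ + v m) * (ℕ→ℚ X + (t + t)) ^ J ≤⟨ ∏[1+v]*[X+2t]^J≤2^J*[X+t]^J X ⟩
    ℕ→ℚ 2 ^ J * (ℕ→ℚ X + t) ^ J                  ≤⟨ *-monoˡ-≤ (ℕ→ℚ 2 ^ J) (^-nonNeg J (ℕ→ℚ-nonNeg 2))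
                                                      (^-monoˡ-≤ J (+-nonNeg (ℕ→ℚ-nonNeg X) 0≤t) (+-monoʳ-≤ (ℕ→ℚ X) (p≤p+q t 0≤t))) ⟩
    ℕ→ℚ 2 ^ J * (ℕ→ℚ X + (t + t)) ^ J            ∎)
    where open ≤-Reasoning

-- Rankin's trick

weight : ℚ → ℕ → ℚ
weight t m = if does (prime? m ×-dec t ℚₚ.≤? ℕ→ℚ m) then ℕ→ℚ K * (recip m * t) else 0ℚ

weight-nonNeg : ∀ {t} → 0ℚ ≤ t → ∀ m → 0ℚ ≤ weight t m
weight-nonNeg {t} 0≤t m = if-nonNeg (does (prime? m ×-dec t ℚₚ.≤? ℕ→ℚ m)) (*-nonNeg (ℕ→ℚ-nonNeg K) (*-nonNeg (recip-nonNeg m) 0≤t))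

weight-prime : ∀ t m → Prime m ⊎ weight t m ≡ 0ℚ
weight-prime t m = by-cases (prime? m ×-dec t ℚₚ.≤? ℕ→ℚ m)
  where
  by-cases : (d : Dec (Prime m × t ≤ ℕ→ℚ m)) → Prime m ⊎ (if does d then ℕ→ℚ K * (recip m * t) else 0ℚ) ≡ 0ℚ
  by-cases (yes (m-prime , _)) = inj₁ m-prime
  by-cases (no _)              = inj₂ refl

weight*recip-bound : ∀ {t} → 1ℚ ≤ t → ∀ m →
  weight t m * recip m * ((1ℚ + ℕ→ℚ m + t) * (ℕ→ℚ m + (t + t))) ≤ ℕ→ℚ (9 ℕ.* K) * t
weight*recip-bound {t} 1≤t m = by-cases (prime? m ×-dec t ℚₚ.≤? ℕ→ℚ m)
  where
  0≤t : 0ℚ ≤ t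
  0≤t = ℚₚ.≤-trans 0≤1 1≤t
  B = (1ℚ + ℕ→ℚ m + t) * (ℕ→ℚ m + (t + t))
  vanish : ∀ r B → 0ℚ * r * B ≡ 0ℚ
  vanish = solve-∀ ℚ-ring
  by-cases : (d : Dec (Prime m × t ≤ ℕ→ℚ m)) →
             (if does d then ℕ→ℚ K * (recip m * t) else 0ℚ) * recip m * B ≤ ℕ→ℚ (9 ℕ.* K) * t
  by-cases (no _) = subst (_≤ ℕ→ℚ (9 ℕ.* K) * t) (sym (vanish (recip m) B)) (*-nonNeg (ℕ→ℚ-nonNeg (9 ℕ.* K)) 0≤t)
  by-cases (yes (m-prime , t≤m)) = prime-case m m-prime t≤m
    where
    prime-case : ∀ m → Prime m → t ≤ ℕ→ℚ m →
                 ℕ→ℚ K * (recip m * t) * recip m * ((1ℚ + ℕ→ℚ m + t) * (ℕ→ℚ m + (t + t))) ≤ ℕ→ℚ (9 ℕ.* K) * t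
    prime-case zero    0-prime _   = ⊥-elim (¬prime[0] 0-prime)
    prime-case (suc m) _       t≤x = begin
      ℕ→ℚ K * (r * t) * r * ((1ℚ + x + t) * (x + (t + t)))
        ≤⟨ *-monoˡ-≤ (ℕ→ℚ K * (r * t) * r) 0≤Krtr (*-mono-≤ 0≤1+x+t 0≤x+2t 1+x+t≤3x x+2t≤3x) ⟩
      ℕ→ℚ K * (r * t) * r * ((x + x + x) * (x + x + x))  ≡⟨ collect (ℕ→ℚ K) r t x ⟩
      ℕ→ℚ 9 * ℕ→ℚ K * t * ((x * r) * (x * r))           ≡⟨ cong (λ y → ℕ→ℚ 9 * ℕ→ℚ K * t * (y * y)) (ℕ→ℚ*recip m) ⟩
      ℕ→ℚ 9 * ℕ→ℚ K * t * (1ℚ * 1ℚ)                     ≡⟨ ℚₚ.*-identityʳ (ℕ→ℚ 9 * ℕ→ℚ K * t) ⟩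
      ℕ→ℚ 9 * ℕ→ℚ K * t                                 ≡⟨ cong (_* t) (sym (ℕ→ℚ-* 9 K)) ⟩
      ℕ→ℚ (9 ℕ.* K) * t                                 ∎
      where
      open ≤-Reasoning
      x = ℕ→ℚ (suc m)
      r = recip (suc m)
      0≤Krtr : 0ℚ ≤ ℕ→ℚ K * (r * t) * r
      0≤Krtr = *-nonNeg (*-nonNeg (ℕ→ℚ-nonNeg K) (*-nonNeg (recip-nonNeg (suc m)) 0≤t)) (recip-nonNeg (suc m))
      0≤1+x+t : 0ℚ ≤ 1ℚ + x + t
      0≤1+x+t = +-nonNeg (+-nonNeg 0≤1 (ℕ→ℚ-nonNeg (suc m))) 0≤t
      0≤x+2t : 0ℚ ≤ x + (t + t)
      0≤x+2t = +-nonNeg (ℕ→ℚ-nonNeg (suc m)) (+-nonNeg 0≤t 0≤t)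
      1+x+t≤3x : 1ℚ + x + t ≤ x + x + x
      1+x+t≤3x = +-mono-≤ (+-monoˡ-≤ x (ℕ→ℚ-mono-≤ {1} {suc m} (s≤s z≤n))) t≤x
      x+2t≤3x : x + (t + t) ≤ x + x + x
      x+2t≤3x = subst (x + (t + t) ≤_) (sym (ℚₚ.+-assoc x x x)) (+-monoʳ-≤ x (+-mono-≤ t≤x t≤x))
      collect : ∀ k r t x → k * (r * t) * r * ((x + x + x) * (x + x + x)) ≡ ℕ→ℚ 9 * k * t * ((x * r) * (x * r))
      collect = solve-∀ ℚ-ring

if-∧-rotate : ∀ p d s (a : ℚ) → (if p ∧ (d ∧ s) then a else 0ℚ) ≡ (if d then (if p ∧ s then a else 0ℚ) else 0ℚ)
if-∧-rotate true  true  s a = refl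
if-∧-rotate true  false s a = refl
if-∧-rotate false true  s a = refl
if-∧-rotate false false s a = refl

primeDivisorFrom? : ∀ t n → Decidable (λ p → Prime p × p ∣ n × t ≤ ℕ→ℚ p)
primeDivisorFrom? t n p = prime? p ×-dec p ∣? n ×-dec t ℚₚ.≤? ℕ→ℚ p

prodℚ-primeDivisorsFrom : ∀ t n →
  prodℚ (map (λ p → 1ℚ + ℕ→ℚ K * (recip p * t)) (primeDivisorsFrom t n)) ≡ divisorProduct (weight t) (suc n) n
prodℚ-primeDivisorsFrom t n = begin
  prodℚ (map (λ p → 1ℚ + ℕ→ℚ K * (recip p * t)) (filter Q? (upTo (suc n))))
    ≡⟨ prodℚ-filter Q? (λ p → ℕ→ℚ K * (recip p * t)) (upTo (suc n)) ⟩
  prodℚ (map (λ m → 1ℚ + (if does (Q? m) then ℕ→ℚ K * (recip m * t) else 0ℚ)) (upTo (suc n)))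
    ≡⟨ cong prodℚ (List.map-cong (λ m → cong (1ℚ +_) (rotate m)) (upTo (suc n))) ⟩
  divisorProduct (weight t) (suc n) n ∎
  where
  open ≡-Reasoning
  Q? = primeDivisorFrom? t n
  rotate : ∀ m → (if does (Q? m) then ℕ→ℚ K * (recip m * t) else 0ℚ) ≡
                 (if does (m ∣? n) then weight t m else 0ℚ)
  rotate m = if-∧-rotate (does (prime? m)) (does (m ∣? n)) (does (t ℚₚ.≤? ℕ→ℚ m)) (ℕ→ℚ K * (recip m * t))

expPartial≤divisorProduct : ∀ {c t} N {n X} → 0ℚ ≤ c → 0ℚ ≤ t → n ℕ.< X → c ≤ S t n →
                            expPartial (ℕ→ℚ 100 * c * t) N ≤ divisorProduct (weight t) X n
expPartial≤divisorProduct {c} {t} N {n} {X} 0≤c 0≤t n<X c≤S = begin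
  expPartial (ℕ→ℚ 100 * c * t) N           ≤⟨ expPartial-mono N 0≤100ct 100ct≤100∑us ⟩
  expPartial (ℕ→ℚ 100 * sumℚ us) N         ≤⟨ expPartial-100*sum≤prod N us us∈[0,1] ⟩
  prodℚ (map (λ u → 1ℚ + ℕ→ℚ K * u) us)   ≡⟨ cong prodℚ (sym (List.map-∘ L)) ⟩
  prodℚ (map (λ p → 1ℚ + ℕ→ℚ K * (recip p * t)) L)
                                           ≡⟨ prodℚ-primeDivisorsFrom t n ⟩
  divisorProduct (weight t) (suc n) n      ≤⟨ ∏-mono-upTo _ (λ m → p≤p+q 1ℚ (if-nonNeg (does (m ∣? n)) (weight-nonNeg 0≤t m))) n<X ⟩
  divisorProduct (weight t) X n            ∎
  where
  open ≤-Reasoning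
  L = primeDivisorsFrom t n
  us = map (λ p → recip p * t) L
  us∈[0,1] : All (λ u → 0ℚ ≤ u × u ≤ 1ℚ) us
  us∈[0,1] = All.map⁺ (All.map (λ { {p} (_ , _ , t≤p) → *-nonNeg (recip-nonNeg p) 0≤t , recip*≤1 p t≤p })
                                (All.all-filter (primeDivisorFrom? t n) (upTo (suc n))))
  0≤100ct : 0ℚ ≤ ℕ→ℚ 100 * c * t
  0≤100ct = *-nonNeg (*-nonNeg (ℕ→ℚ-nonNeg 100) 0≤c) 0≤t
  100ct≤100∑us : ℕ→ℚ 100 * c * t ≤ ℕ→ℚ 100 * sumℚ us
  100ct≤100∑us = begin
    ℕ→ℚ 100 * c * t                 ≤⟨ *-monoʳ-≤ t 0≤t (*-monoˡ-≤ (ℕ→ℚ 100) (ℕ→ℚ-nonNeg 100) c≤S) ⟩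
    ℕ→ℚ 100 * S t n * t             ≡⟨ ℚₚ.*-assoc (ℕ→ℚ 100) (S t n) t ⟩
    ℕ→ℚ 100 * (S t n * t)           ≡⟨ cong (ℕ→ℚ 100 *_) (sym (sumℚ-*ʳ recip t L)) ⟩
    ℕ→ℚ 100 * sumℚ us               ∎

count*expPartial≤∑divisorProduct : ∀ x {t c} N → 0ℚ ≤ t → 0ℚ ≤ c →
  ℕ→ℚ (count x t c) * expPartial (ℕ→ℚ 100 * c * t) N ≤
  ∑[ k < ℤ.∣ floor x ∣ ] divisorProduct (weight t) (suc ℤ.∣ floor x ∣) (suc k)
count*expPartial≤∑divisorProduct x {t} {c} N 0≤t 0≤c = begin
  ℕ→ℚ (count x t c) * E                          ≤⟨ length-filter*≤sum (λ n → c ℚₚ.≤? S t n) E≤D 0≤D ⟩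
  sumℚ (map (divisorProduct w (suc Y)) (map suc (upTo Y))) ≡⟨ cong sumℚ (sym (List.map-∘ (upTo Y))) ⟩
  ∑[ k < Y ] divisorProduct w (suc Y) (suc k)    ∎
  where
  open ≤-Reasoning
  Y = ℤ.∣ floor x ∣
  w = weight t
  E = expPartial (ℕ→ℚ 100 * c * t) N
  E≤D : All (λ n → c ≤ S t n → E ≤ divisorProduct w (suc Y) n) (map suc (upTo Y))
  E≤D = All.map⁺ (All.map (λ k<Y → expPartial≤divisorProduct N 0≤c 0≤t (s≤s k<Y)) (All.all-upTo Y))
  0≤D : All (λ n → 0ℚ ≤ divisorProduct w (suc Y) n) (map suc (upTo Y))
  0≤D = All.universal (divisorProduct-nonNeg (weight-nonNeg 0≤t) (suc Y)) _

eulerProduct-weight≤ : ∀ {t} → 1ℚ ≤ t → ∀ X → eulerProduct (weight t) X ≤ ℕ→ℚ 2 ^ (9 ℕ.* K)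
eulerProduct-weight≤ {t} 1≤t = ∏[1+v]≤2^J (9 ℕ.* K) 0<t 0≤v (weight*recip-bound 1≤t)
  where
  0<t : 0ℚ < t
  0<t = ℚₚ.<-≤-trans (ℚₚ.positive⁻¹ 1ℚ) 1≤t
  0≤v : ∀ m → 0ℚ ≤ weight t m * recip m
  0≤v m = *-nonNeg (weight-nonNeg (<⇒≤ 0<t) m) (recip-nonNeg m)

lemma4 : ∃[ C ] ((x t c : ℚ) → 1ℚ ≤ x → 1ℚ ≤ t → 0ℚ < c → c ≤ 1ℚ →
           (N : ℕ) → ℕ→ℚ (count x t c) * expPartial (ℕ→ℚ 100 * c * t) N ≤ C * x)
lemma4 = C , bound
  where
  C = ℕ→ℚ 2 ^ (9 ℕ.* K)
  bound : (x t c : ℚ) → 1ℚ ≤ x → 1ℚ ≤ t → 0ℚ < c → c ≤ 1ℚ →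
          (N : ℕ) → ℕ→ℚ (count x t c) * expPartial (ℕ→ℚ 100 * c * t) N ≤ C * x
  bound x t c 1≤x 1≤t 0<c _ N = begin
    ℕ→ℚ (count x t c) * expPartial (ℕ→ℚ 100 * c * t) N ≤⟨ count*expPartial≤∑divisorProduct x N 0≤t (<⇒≤ 0<c) ⟩
    ∑[ k < Y ] divisorProduct (weight t) (suc Y) (suc k) ≤⟨ ∑-divisorProduct≤ (weight-nonNeg 0≤t) (weight-prime t) (suc Y) Y ⟩
    ℕ→ℚ Y * eulerProduct (weight t) (suc Y)            ≤⟨ *-monoˡ-≤ (ℕ→ℚ Y) (ℕ→ℚ-nonNeg Y) (eulerProduct-weight≤ 1≤t (suc Y)) ⟩
    ℕ→ℚ Y * C                                          ≤⟨ *-monoʳ-≤ C (^-nonNeg (9 ℕ.* K) (ℕ→ℚ-nonNeg 2)) (ℕ→ℚ∣floor∣≤ x (ℚₚ.≤-trans 0≤1 1≤x)) ⟩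
    x * C                                              ≡⟨ ℚₚ.*-comm x C ⟩
    C * x                                              ∎
    where
    open ≤-Reasoning
    Y = ℤ.∣ floor x ∣
    0≤t = ℚₚ.≤-trans 0≤1 1≤t
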